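{- Let $M$ and $N$ be integers with $2 \leq N < M$, let $p_*$ be the largest prime factor of $N$, and let $k_*$ be the largest integer such that $N p_*^{k_*} < M$. Suppose that \[ \frac{\sigma(N)}{N} \cdot \frac{p_*^{k_*}}{(p_*-1)^{k_*}} < 2. \] Then every descendant $N'$ of $N$ with $N' < M$ is deficient, i.e., satisfies $\sigma(N') < 2N'$.
   Context: $\sigma(n)$ denotes the sum of all positive divisors of $n$. For an integer $N \geq 2$ with largest prime factor $p_*$, the descendants of $N$ are the integers of the form $N q_1 q_2 \cdots q_k$ with $k \geq 1$ and $q_1, \ldots, q_k$ (not necessarily distinct) primes with $q_i \geq p_*$ for all $i$. (Equivalently, with $\mathrm{pred}(n)$ defined as $n$ divided by its largest prime factor, the descendants of $N$ are the integers $n$ such that iterating $\mathrm{pred}$ on $n$ eventually yields $N$.) -}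

module Defs where

open import Data.Nat using (ℕ; zero; suc; _+_; _*_; _≤_; _<_)
open import Data.Nat.Divisibility using (_∣_; _∣?_)
open import Data.Nat.Primality using (Prime)
open import Data.List using (List; []; _∷_; filter; upTo; map; length)
open import Data.Nat.ListAction using (sum; product)
open import Data.List.Relation.Unary.All using (All)
open import Data.Product using (_×_; Σ; ∃-syntax)
open import Relation.Binary.PropositionalEquality using (_≡_)

-- σ n = sum of the positive divisors of n (σ 0 = 0 by this definition; unused)
σ : ℕ → ℕ
σ n = sum (filter (λ d → d ∣? n) (map suc (upTo n)))

IsLargestPrimeFactor : ℕ → ℕ → Set
IsLargestPrimeFactor p n = Prime p × p ∣ n × (∀ q → Prime q → q ∣ n → q ≤ p)

-- n is a descendant of N, where N has largest prime factor p:
-- n = N * q₁ * ... * q_k with k ≥ 1 and every qᵢ a prime with qᵢ ≥ p.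
IsDescendant : (N p n : ℕ) → Set
IsDescendant N p n =
  ∃[ qs ] (1 ≤ length qs × All (λ q → Prime q × p ≤ q) qs × n ≡ N * product qs)

{-# OPTIONS --safe #-}
module Submission where

-- For a prime q and n ≥ 1 every divisor of q n either divides n or is q times
-- a divisor of n, so σ (q n) ≤ (q + 1) σ n; this is proved for the divisor sums
-- truncated at t, by induction on t = q m + r. For a prime q ≥ p it gives
-- σ (q n) / (q n) ≤ (q + 1) / q ≤ p / (p − 1), hence a descendant N q₁ ⋯ q_j
-- of N has abundancy at most σ N / N · (p / (p − 1)) ^ j. Such a descendant is
-- at least N p ^ j, so it lies below M only if j ≤ k, and the hypothesis
-- bounds its abundancy below 2.

open import Defs
open import Data.Nat
  using (ℕ; suc; _+_; _*_; _∸_; _^_; _≤_; _<_; _≤′_; ≤′-refl; ≤′-step; z≤n; s≤s; z<s; NonZero; >-nonZero; >-nonZero⁻¹)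
open import Data.Nat.Properties
open import Data.Nat.Divisibility using (_∣_; _∣?_; ∣⇒≤; ∣m+n∣m⇒∣n; *-cancelˡ-∣; m∣m*n)
open import Data.Nat.Primality using (Prime; prime⇒irreducible; prime⇒nonZero; productOfPrimes≢0)
open import Data.Nat.Coprimality using (Coprime; coprime-divisor)
open import Data.List using (List; []; _∷_; filter; upTo; map; length; _++_; [_])
open import Data.List.Properties using (upTo-∷ʳ; map-++; filter-++; filter-accept; filter-reject)
open import Data.Nat.ListAction using (sum; product)
open import Data.Nat.ListAction.Properties using (sum-++)
open import Data.List.Relation.Unary.All as All using (All; []; _∷_)
open import Data.Product using (_×_; _,_; proj₁)
open import Data.Sum using (inj₁; inj₂)
open import Relation.Nullary using (¬_; yes; no; contradiction)
open import Relation.Binary.PropositionalEquality using (_≡_; refl; sym; trans; cong; subst; module ≡-Reasoning)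
import Algebra.Properties.CommutativeSemigroup as CommSemigroupProperties

open CommSemigroupProperties +-commutativeSemigroup using () renaming (xy∙z≈xz∙y to xy+z≡xz+y)
open CommSemigroupProperties *-commutativeSemigroup using ()
  renaming (x∙yz≈y∙xz to x*yz≡y*xz; xy∙z≈xz∙y to xy*z≡xz*y; interchange to *-interchange)

σ≤ : ℕ → ℕ → ℕ
σ≤ n t = sum (filter (_∣? n) (map suc (upTo t)))

σ≤-suc : ∀ n t → σ≤ n (suc t) ≡ σ≤ n t + sum (filter (_∣? n) [ suc t ])
σ≤-suc n t = begin
  sum (filter (_∣? n) (map suc (upTo (suc t))))          ≡⟨ cong (λ ds → sum (filter (_∣? n) (map suc ds))) (upTo-∷ʳ t) ⟨
  sum (filter (_∣? n) (map suc (upTo t ++ [ t ])))       ≡⟨ cong (λ ds → sum (filter (_∣? n) ds)) (map-++ suc (upTo t) [ t ]) ⟩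
  sum (filter (_∣? n) (map suc (upTo t) ++ [ suc t ]))   ≡⟨ cong sum (filter-++ (_∣? n) (map suc (upTo t)) [ suc t ]) ⟩
  sum (filter (_∣? n) (map suc (upTo t)) ++ filter (_∣? n) [ suc t ]) ≡⟨ sum-++ (filter (_∣? n) (map suc (upTo t))) _ ⟩
  σ≤ n t + sum (filter (_∣? n) [ suc t ])                 ∎
  where open ≡-Reasoning

σ≤-suc-∣ : ∀ {n t} → suc t ∣ n → σ≤ n (suc t) ≡ σ≤ n t + suc t
σ≤-suc-∣ {n} {t} t+1∣n = trans (σ≤-suc n t)
  (cong (σ≤ n t +_) (trans (cong sum (filter-accept (_∣? n) {xs = []} t+1∣n)) (+-identityʳ (suc t))))

σ≤-suc-∤ : ∀ {n t} → ¬ suc t ∣ n → σ≤ n (suc t) ≡ σ≤ n t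
σ≤-suc-∤ {n} {t} t+1∤n = trans (σ≤-suc n t)
  (trans (cong (λ ds → σ≤ n t + sum ds) (filter-reject (_∣? n) {xs = []} t+1∤n)) (+-identityʳ (σ≤ n t)))

σ≤-≤-suc : ∀ n t → σ≤ n t ≤ σ≤ n (suc t)
σ≤-≤-suc n t with suc t ∣? n
... | yes t+1∣n = ≤-trans (m≤m+n _ _) (≤-reflexive (sym (σ≤-suc-∣ t+1∣n)))
... | no  t+1∤n = ≤-reflexive (sym (σ≤-suc-∤ t+1∤n))

σ≤-mono : ∀ n {s t} → s ≤ t → σ≤ n s ≤ σ≤ n t
σ≤-mono n s≤t = go (≤⇒≤′ s≤t)
  where
  go : ∀ {s t} → s ≤′ t → σ≤ n s ≤ σ≤ n t
  go ≤′-refl         = ≤-refl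
  go (≤′-step {t} p) = ≤-trans (go p) (σ≤-≤-suc n t)

σ≤≡σ : ∀ n .{{_ : NonZero n}} {t} → n ≤ t → σ≤ n t ≡ σ n
σ≤≡σ n n≤t = go (≤⇒≤′ n≤t)
  where
  go : ∀ {t} → n ≤′ t → σ≤ n t ≡ σ n
  go ≤′-refl         = refl
  go (≤′-step {t} p) = trans (σ≤-suc-∤ (λ t+1∣n → <⇒≱ (s≤s (≤′⇒≤ p)) (∣⇒≤ t+1∣n))) (go p)

prime∤⇒coprime : ∀ {p m} → Prime p → ¬ p ∣ m → Coprime m p
prime∤⇒coprime p-prime p∤m (d∣m , d∣p) with prime⇒irreducible p-prime d∣p
... | inj₁ d≡1 = d≡1
... | inj₂ refl = contradiction d∣m p∤m

module _ (n q : ℕ) where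
  open ≤-Reasoning

  σ≤-*-step-∤ : ∀ {t m m′} → ¬ suc t ∣ q * n → m ≤ m′ →
                σ≤ (q * n) t ≤ σ≤ n t + q * σ≤ n m →
                σ≤ (q * n) (suc t) ≤ σ≤ n (suc t) + q * σ≤ n m′
  σ≤-*-step-∤ {t} {m} {m′} t+1∤qn m≤m′ ih = begin
    σ≤ (q * n) (suc t)         ≡⟨ σ≤-suc-∤ t+1∤qn ⟩
    σ≤ (q * n) t               ≤⟨ ih ⟩
    σ≤ n t + q * σ≤ n m        ≤⟨ +-mono-≤ (σ≤-≤-suc n t) (*-monoʳ-≤ q (σ≤-mono n m≤m′)) ⟩
    σ≤ n (suc t) + q * σ≤ n m′ ∎

  σ≤-*-step-coprime : ∀ {t m} → (suc t ∣ q * n → suc t ∣ n) →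
                      σ≤ (q * n) t ≤ σ≤ n t + q * σ≤ n m →
                      σ≤ (q * n) (suc t) ≤ σ≤ n (suc t) + q * σ≤ n m
  σ≤-*-step-coprime {t} {m} t+1∣n ih with suc t ∣? q * n
  ... | no  t+1∤qn = σ≤-*-step-∤ {m = m} t+1∤qn ≤-refl ih
  ... | yes t+1∣qn = begin
    σ≤ (q * n) (suc t)          ≡⟨ σ≤-suc-∣ t+1∣qn ⟩
    σ≤ (q * n) t + suc t        ≤⟨ +-monoˡ-≤ (suc t) ih ⟩
    σ≤ n t + q * σ≤ n m + suc t ≡⟨ xy+z≡xz+y (σ≤ n t) (q * σ≤ n m) (suc t) ⟩
    σ≤ n t + suc t + q * σ≤ n m ≡⟨ cong (_+ q * σ≤ n m) (σ≤-suc-∣ (t+1∣n t+1∣qn)) ⟨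
    σ≤ n (suc t) + q * σ≤ n m   ∎

  σ≤-*-step-multiple : ∀ {t m} → suc t ≡ q * suc m → (suc t ∣ q * n → suc m ∣ n) →
                       σ≤ (q * n) t ≤ σ≤ n t + q * σ≤ n m →
                       σ≤ (q * n) (suc t) ≤ σ≤ n (suc t) + q * σ≤ n (suc m)
  σ≤-*-step-multiple {t} {m} t+1≡q[m+1] m+1∣n ih with suc t ∣? q * n
  ... | no  t+1∤qn = σ≤-*-step-∤ {m = m} t+1∤qn (n≤1+n m) ih
  ... | yes t+1∣qn = begin
    σ≤ (q * n) (suc t)                ≡⟨ σ≤-suc-∣ t+1∣qn ⟩
    σ≤ (q * n) t + suc t              ≤⟨ +-monoˡ-≤ (suc t) ih ⟩
    σ≤ n t + q * σ≤ n m + suc t       ≡⟨ cong (σ≤ n t + q * σ≤ n m +_) t+1≡q[m+1] ⟩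
    σ≤ n t + q * σ≤ n m + q * suc m   ≡⟨ +-assoc (σ≤ n t) _ _ ⟩
    σ≤ n t + (q * σ≤ n m + q * suc m) ≡⟨ cong (σ≤ n t +_) (*-distribˡ-+ q (σ≤ n m) (suc m)) ⟨
    σ≤ n t + q * (σ≤ n m + suc m)     ≡⟨ cong (λ s → σ≤ n t + q * s) (σ≤-suc-∣ (m+1∣n t+1∣qn)) ⟨
    σ≤ n t + q * σ≤ n (suc m)         ≤⟨ +-monoˡ-≤ _ (σ≤-≤-suc n t) ⟩
    σ≤ n (suc t) + q * σ≤ n (suc m)   ∎

σ≤-*-prime : ∀ {q} n → Prime q → ∀ t m r → r < q → t ≡ q * m + r →
             σ≤ (q * n) t ≤ σ≤ n t + q * σ≤ n m
σ≤-*-prime _ _ 0 _ _ _ _ = z≤n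
σ≤-*-prime {q} n q-prime (suc t) m (suc r) r+1<q t+1≡ =
  σ≤-*-step-coprime n q {m = m} (coprime-divisor (prime∤⇒coprime q-prime q∤t+1))
    (σ≤-*-prime n q-prime t m r (<⇒≤ r+1<q) (suc-injective (trans t+1≡ (+-suc (q * m) r))))
  where
  q∤t+1 : ¬ q ∣ suc t
  q∤t+1 q∣t+1 = <⇒≱ r+1<q (∣⇒≤ (∣m+n∣m⇒∣n (subst (q ∣_) t+1≡ q∣t+1) (m∣m*n m)))
σ≤-*-prime {q} n q-prime (suc t) 0 0 _ t+1≡ =
  contradiction (trans t+1≡ (trans (+-identityʳ (q * 0)) (*-zeroʳ q))) λ ()
σ≤-*-prime {q@(suc q′)} n q-prime (suc t) (suc m) 0 _ t+1≡ =
  σ≤-*-step-multiple n q {m = m} t+1≡q[m+1] (λ t+1∣qn → *-cancelˡ-∣ q (subst (_∣ q * n) t+1≡q[m+1] t+1∣qn))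
    (σ≤-*-prime n q-prime t m q′ ≤-refl (suc-injective t+1≡q*m+q))
  where
  t+1≡q[m+1] : suc t ≡ q * suc m
  t+1≡q[m+1] = trans t+1≡ (+-identityʳ (q * suc m))
  t+1≡q*m+q : suc t ≡ suc (q * m + q′)
  t+1≡q*m+q = trans t+1≡q[m+1] (trans (*-suc q m) (cong suc (+-comm q′ (q * m))))

σ-*-prime≤ : ∀ {q} n .{{_ : NonZero n}} → Prime q → σ (q * n) ≤ suc q * σ n
σ-*-prime≤ {q} n q-prime = begin
  σ≤ (q * n) (q * n)         ≤⟨ σ≤-*-prime n q-prime (q * n) n 0 (>-nonZero⁻¹ q) (sym (+-identityʳ (q * n))) ⟩
  σ≤ n (q * n) + q * σ≤ n n  ≡⟨ cong (_+ q * σ n) (σ≤≡σ n (m≤n*m n q)) ⟩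
  σ n + q * σ n              ∎
  where
  open ≤-Reasoning
  instance
    _ : NonZero q
    _ = prime⇒nonZero q-prime

p≤q⇒[1+q]*[p∸1]≤q*p : ∀ {p q} → p ≤ q → suc q * (p ∸ 1) ≤ q * p
p≤q⇒[1+q]*[p∸1]≤q*p {0}     {q} _          = ≤-reflexive (trans (*-zeroʳ (suc q)) (sym (*-zeroʳ q)))
p≤q⇒[1+q]*[p∸1]≤q*p {suc p} {q} (s≤s p≤q′) = begin
  suc q * p      ≡⟨⟩
  p + q * p      ≤⟨ +-monoˡ-≤ (q * p) (m≤n⇒m≤1+n p≤q′) ⟩
  q + q * p      ≡⟨ *-suc q p ⟨
  q * suc p      ∎
  where open ≤-Reasoning

PrimesAtLeast : ℕ → List ℕ → Set
PrimesAtLeast p = All (λ q → Prime q × p ≤ q)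

product-nonZero : ∀ {p qs} → PrimesAtLeast p qs → NonZero (product qs)
product-nonZero qs≥p = productOfPrimes≢0 (All.map proj₁ qs≥p)

^length≤product : ∀ {p qs} → PrimesAtLeast p qs → p ^ length qs ≤ product qs
^length≤product []                 = ≤-refl
^length≤product ((_ , p≤q) ∷ qs≥p) = *-mono-≤ p≤q (^length≤product qs≥p)

σ-*-product≤ : ∀ {p} N .{{_ : NonZero N}} qs → PrimesAtLeast p qs →
               σ (N * product qs) * (p ∸ 1) ^ length qs ≤ σ N * product qs * p ^ length qs
σ-*-product≤ N [] [] = ≤-reflexive (trans (cong (λ n → σ n * 1) (*-identityʳ N)) (sym (*-identityʳ (σ N * 1))))
σ-*-product≤ {p} N (q ∷ qs) ((q-prime , p≤q) ∷ qs≥p) = begin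
  σ (N * (q * P)) * ((p ∸ 1) * (p ∸ 1) ^ j)   ≡⟨ cong (λ n → σ n * ((p ∸ 1) * (p ∸ 1) ^ j)) (x*yz≡y*xz N q P) ⟩
  σ (q * (N * P)) * ((p ∸ 1) * (p ∸ 1) ^ j)   ≤⟨ *-monoˡ-≤ _ (σ-*-prime≤ (N * P) {{m*n≢0 N P}} q-prime) ⟩
  suc q * σ (N * P) * ((p ∸ 1) * (p ∸ 1) ^ j) ≡⟨ *-interchange (suc q) (σ (N * P)) (p ∸ 1) _ ⟩
  suc q * (p ∸ 1) * (σ (N * P) * (p ∸ 1) ^ j) ≤⟨ *-mono-≤ (p≤q⇒[1+q]*[p∸1]≤q*p p≤q) (σ-*-product≤ N qs qs≥p) ⟩
  q * p * (σ N * P * p ^ j)                   ≡⟨ *-interchange q p (σ N * P) (p ^ j) ⟩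
  q * (σ N * P) * (p * p ^ j)                 ≡⟨ cong (_* (p * p ^ j)) (x*yz≡y*xz q (σ N) P) ⟩
  σ N * (q * P) * (p * p ^ j)                 ∎
  where
  open ≤-Reasoning
  P = product qs
  j = length qs
  instance
    _ : NonZero P
    _ = product-nonZero qs≥p

m*x^j≤n*y^j⇒m*x^k≤n*y^k : ∀ m n {x y j k} → x ≤ y → j ≤ k → m * x ^ j ≤ n * y ^ j → m * x ^ k ≤ n * y ^ k
m*x^j≤n*y^j⇒m*x^k≤n*y^k m n {x} {y} x≤y j≤k base = go (≤⇒≤′ j≤k)
  where
  open ≤-Reasoning
  go : ∀ {k} → _ ≤′ k → m * x ^ k ≤ n * y ^ k
  go ≤′-refl         = base
  go (≤′-step {k} p) = begin
    m * (x * x ^ k)  ≡⟨ x*yz≡y*xz m x (x ^ k) ⟩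
    x * (m * x ^ k)  ≤⟨ *-mono-≤ x≤y (go p) ⟩
    y * (n * y ^ k)  ≡⟨ x*yz≡y*xz n y (y ^ k) ⟨
    n * (y * y ^ k)  ∎

m*p^j<m*p^[1+k]⇒j≤k : ∀ m p .{{_ : NonZero p}} {j k} → m * p ^ j < m * p ^ suc k → j ≤ k
m*p^j<m*p^[1+k]⇒j≤k m p {j} {k} lt with j ≤? k
... | yes j≤k = j≤k
... | no  j≰k = contradiction (*-monoʳ-≤ m (^-monoʳ-≤ p (≰⇒> j≰k))) (<⇒≱ lt)

proposition6 : (M N p k : ℕ) → 2 ≤ N → N < M →
    IsLargestPrimeFactor p N →
    N * p ^ k < M → M ≤ N * p ^ (k + 1) →
    σ N * p ^ k < 2 * N * (p ∸ 1) ^ k →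
    ∀ N′ → IsDescendant N p N′ → N′ < M → σ N′ < 2 * N′
proposition6 M N p k 2≤N _ (p-prime , _) _ M≤Np^[k+1] abundancy<2 _ (qs , _ , qs≥p , refl) N′<M =
  *-cancelʳ-< ((p ∸ 1) ^ k) (σ N′) (2 * N′) (begin-strict
    σ N′ * (p ∸ 1) ^ k           ≤⟨ m*x^j≤n*y^j⇒m*x^k≤n*y^k (σ N′) (σ N * P) (m∸n≤m p 1) j≤k (σ-*-product≤ N qs qs≥p) ⟩
    σ N * P * p ^ k              ≡⟨ xy*z≡xz*y (σ N) P (p ^ k) ⟩
    σ N * p ^ k * P              <⟨ *-monoˡ-< P abundancy<2 ⟩
    2 * N * (p ∸ 1) ^ k * P      ≡⟨ xy*z≡xz*y (2 * N) ((p ∸ 1) ^ k) P ⟩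
    2 * N * P * (p ∸ 1) ^ k      ≡⟨ cong (_* (p ∸ 1) ^ k) (*-assoc 2 N P) ⟩
    2 * N′ * (p ∸ 1) ^ k         ∎)
  where
  open ≤-Reasoning
  P = product qs
  N′ = N * P
  instance
    _ : NonZero N
    _ = >-nonZero (<-trans z<s 2≤N)
    _ : NonZero p
    _ = prime⇒nonZero p-prime
    _ : NonZero P
    _ = product-nonZero qs≥p
  j≤k : length qs ≤ k
  j≤k = m*p^j<m*p^[1+k]⇒j≤k N p (begin-strict
    N * p ^ length qs   ≤⟨ *-monoʳ-≤ N (^length≤product qs≥p) ⟩
    N′                  <⟨ N′<M ⟩
    M                   ≤⟨ M≤Np^[k+1] ⟩
    N * p ^ (k + 1)     ≡⟨ cong (λ e → N * p ^ e) (+-comm k 1) ⟩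
    N * p ^ suc k       ∎)
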